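{- Let $L$ be a Latin square of order $n$ and let $\mathcal{P}$ be a partial minimal cover of $L$. Then $L$ contains a minimal cover of size at least $|\mathcal{P}|$.
   Context: A Latin square of order $n$ is an $n\times n$ array on $n$ symbols in which each symbol occurs once in each row and each column; its set of entries is $E(L)=\{(i,j,L_{ij})\}$. A line is the set of all entries in a given row, in a given column, or with a given symbol; a set of entries represents a line if it meets it. For $\mathcal{P}\subseteq E(L)$, an entry $\mathbf{e}\in\mathcal{P}$ is redundant if $\mathcal{P}$ and $\mathcal{P}\setminus\{\mathbf{e}\}$ represent the same lines. A partial minimal cover is any $\mathcal{P}\subseteq E(L)$ with no redundant entries. A cover is a subset of $E(L)$ meeting every line; a cover $\mathscr{C}$ is minimal if $\mathscr{C}\setminus\{\mathbf{e}\}$ is not a cover for all $\mathbf{e}\in\mathscr{C}$. -}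

module Defs where

open import Data.Nat using (ℕ; _+_)
open import Data.Fin using (Fin)
open import Data.Bool using (Bool; true; false; if_then_else_)
open import Data.Product using (Σ; ∃; _×_; _,_)
open import Relation.Binary.PropositionalEquality using (_≡_; _≢_)
open import Relation.Nullary using (¬_)
open import Function using (_⇔_)
open import Data.Fin using (_≟_)
open import Relation.Nullary.Decidable using (does)
open import Data.Bool using (_∧_; not)
open import Data.List using (List; map)
open import Data.Nat.ListAction using (sum)
open import Data.List using (allFin)

record LatinSquare (n : ℕ) : Set where
  field
    cell : Fin n → Fin n → Fin n
    row-surj : ∀ i s → ∃ λ j → cell i j ≡ s
    col-surj : ∀ j s → ∃ λ i → cell i j ≡ s
    row-inj : ∀ i j j' → cell i j ≡ cell i j' → j ≡ j'
    col-inj : ∀ j i i' → cell i j ≡ cell i' j → i ≡ i'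
open LatinSquare public

-- An entry (i , j , L i j) is determined by its cell (i , j).
-- A set of entries of L is represented by its (decidable, finite) characteristic
-- function on cells.
EntrySet : ℕ → Set
EntrySet n = Fin n → Fin n → Bool

_∈E_ : ∀ {n} → Fin n × Fin n → EntrySet n → Set
(i , j) ∈E P = P i j ≡ true

size : ∀ {n} → EntrySet n → ℕ
size {n} P = sum (map (λ i → sum (map (λ j → if P i j then 1 else 0) (allFin n))) (allFin n))

remove : ∀ {n} → EntrySet n → Fin n × Fin n → EntrySet n
remove P (a , b) i j = P i j ∧ not (does (a ≟ i) ∧ does (b ≟ j))

data Line (n : ℕ) : Set where
  row : Fin n → Line n
  col : Fin n → Line n
  sym : Fin n → Line n

OnLine : ∀ {n} → LatinSquare n → Fin n → Fin n → Line n → Set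
OnLine L i j (row r) = i ≡ r
OnLine L i j (col c) = j ≡ c
OnLine L i j (sym s) = cell L i j ≡ s

Represents : ∀ {n} → LatinSquare n → EntrySet n → Line n → Set
Represents L P ℓ = ∃ λ i → ∃ λ j → (i , j) ∈E P × OnLine L i j ℓ

Redundant : ∀ {n} → LatinSquare n → EntrySet n → Fin n × Fin n → Set
Redundant L P e = e ∈E P × (∀ ℓ → Represents L P ℓ ⇔ Represents L (remove P e) ℓ)

PartialMinimalCover : ∀ {n} → LatinSquare n → EntrySet n → Set
PartialMinimalCover L P = ∀ e → ¬ Redundant L P e

Cover : ∀ {n} → LatinSquare n → EntrySet n → Set
Cover L C = ∀ ℓ → Represents L C ℓ

MinimalCover : ∀ {n} → LatinSquare n → EntrySet n → Set
MinimalCover L C = Cover L C × (∀ e → e ∈E C → ¬ Cover L (remove C e))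

module Submission where

-- Call an entry set S irredundant when every entry p of S has a
-- private line: a line through p that no other entry of S meets.  A partial
-- minimal cover is irredundant, and an irredundant cover is a minimal cover.
-- So it suffices to enlarge P, never decreasing its size and staying
-- irredundant, until it meets every line.
--
-- Growth step: let S be irredundant and u a line that S misses.  Adding an
-- entry e of u keeps irredundant every old entry except those all of whose
-- private lines pass through e (the entries that "die").  Using the Latin
-- property we choose e on u so that all dying entries are private on one
-- common line; then at most one entry dies, and swapping it for e (or simply
-- adding e if nothing dies) yields an irredundant set that is at least as
-- large, still meets every line S met, and also meets u.

open import Defs
open import Data.Nat using (ℕ; suc; _≤_)
open import Data.Nat.Properties using (≤-refl; ≤-trans; ≤-reflexive; n≤1+n; +-suc; suc-injective)
open import Data.Nat.ListAction using (sum)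
open import Data.Fin using (Fin; _≟_) renaming (zero to fzero; suc to fsuc)
open import Data.Fin.Properties using (any?) renaming (suc-injective to fsuc-injective)
open import Data.Bool using (Bool; true; false; _∧_; _∨_; not; if_then_else_)
open import Data.Bool.Properties using (∨-zeroʳ; ∨-identityʳ; ∧-zeroʳ; ∧-identityʳ; ¬-not)
import Data.Bool.Properties as Bool
open import Data.Product using (∃; Σ; _×_; _,_; proj₁; proj₂)
open import Data.Product.Properties using (≡-dec)
open import Data.Sum using (_⊎_; inj₁; inj₂)
open import Data.Empty using (⊥-elim)
open import Data.List using (List; []; _∷_; map; tabulate; allFin; _++_)
open import Data.List.Properties using (map-tabulate; tabulate-cong; map-cong)
open import Data.List.Relation.Unary.All using (All; []; _∷_)
open import Data.List.Relation.Unary.All.Properties using (tabulate⁻; ++⁻ˡ; ++⁻ʳ)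
open import Relation.Binary.PropositionalEquality
  using (_≡_; _≢_; refl; cong; cong₂; trans; subst) renaming (sym to ≡-sym)
open import Relation.Nullary using (¬_; Dec; yes; no; does)
open import Relation.Nullary.Decidable using (_×-dec_; ¬?; dec-true; decidable-stable)
open import Function using (_∘_; mk⇔)

sum-bump : ∀ {m} (f g : Fin m → ℕ) (a : Fin m) → g a ≡ suc (f a) →
           (∀ x → x ≢ a → g x ≡ f x) → sum (tabulate g) ≡ suc (sum (tabulate f))
sum-bump {suc m} f g fzero ga rest
  rewrite ga | tabulate-cong {f = g ∘ fsuc} {g = f ∘ fsuc} (λ x → rest (fsuc x) λ ()) = refl
sum-bump {suc m} f g (fsuc a) ga rest
  rewrite rest fzero (λ ())
        | sum-bump (f ∘ fsuc) (g ∘ fsuc) a ga (λ x x≢a → rest (fsuc x) (x≢a ∘ fsuc-injective))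
  = +-suc (f fzero) _

sumAll-bump : ∀ {m} (f g : Fin m → ℕ) (a : Fin m) → g a ≡ suc (f a) →
              (∀ x → x ≢ a → g x ≡ f x) →
              sum (map g (allFin m)) ≡ suc (sum (map f (allFin m)))
sumAll-bump f g a ga rest
  rewrite map-tabulate (λ x → x) f | map-tabulate (λ x → x) g = sum-bump f g a ga rest

Cell : ℕ → Set
Cell n = Fin n × Fin n

_≟ᶜ_ : ∀ {n} (c d : Cell n) → Dec (c ≡ d)
_≟ᶜ_ = ≡-dec _≟_ _≟_

_at_ : ∀ {n} → EntrySet n → Cell n → Bool
S at (i , j) = S i j

isCell : ∀ {n} → Cell n → Cell n → Bool
isCell (a , b) (i , j) = does (a ≟ i) ∧ does (b ≟ j)

isCell-self : ∀ {n} (c : Cell n) → isCell c c ≡ true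
isCell-self (a , b) rewrite dec-true (a ≟ a) refl | dec-true (b ≟ b) refl = refl

isCell-other : ∀ {n} (c d : Cell n) → d ≢ c → isCell c d ≡ false
isCell-other (a , b) (i , j) d≢c with a ≟ i | b ≟ j
... | yes refl | yes refl = ⊥-elim (d≢c refl)
... | yes _    | no _     = refl
... | no _     | _        = refl

add : ∀ {n} → EntrySet n → Cell n → EntrySet n
add S c i j = S i j ∨ isCell c (i , j)

add-self : ∀ {n} (S : EntrySet n) (c : Cell n) → add S c at c ≡ true
add-self S c = trans (cong (S at c ∨_) (isCell-self c)) (∨-zeroʳ (S at c))

add-other : ∀ {n} (S : EntrySet n) (c d : Cell n) → d ≢ c → add S c at d ≡ S at d
add-other S c d d≢c = trans (cong (S at d ∨_) (isCell-other c d d≢c)) (∨-identityʳ (S at d))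

remove-self : ∀ {n} (S : EntrySet n) (c : Cell n) → remove S c at c ≡ false
remove-self S c = trans (cong (λ t → S at c ∧ not t) (isCell-self c)) (∧-zeroʳ (S at c))

remove-other : ∀ {n} (S : EntrySet n) (c d : Cell n) → d ≢ c → remove S c at d ≡ S at d
remove-other S c d d≢c =
  trans (cong (λ t → S at d ∧ not t) (isCell-other c d d≢c)) (∧-identityʳ (S at d))

∈-add : ∀ {n} (S : EntrySet n) (c d : Cell n) → d ∈E S → d ∈E add S c
∈-add S c d d∈S with d ≟ᶜ c
... | yes refl = add-self S c
... | no d≢c   = trans (add-other S c d d≢c) d∈S

∈-add⁻ : ∀ {n} (S : EntrySet n) (c d : Cell n) → d ∈E add S c → d ∈E S ⊎ d ≡ c
∈-add⁻ S c d d∈ with d ≟ᶜ c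
... | yes d≡c = inj₂ d≡c
... | no d≢c  = inj₁ (trans (≡-sym (add-other S c d d≢c)) d∈)

∈-remove : ∀ {n} (S : EntrySet n) (c d : Cell n) → d ∈E S → d ≢ c → d ∈E remove S c
∈-remove S c d d∈S d≢c = trans (remove-other S c d d≢c) d∈S

∈-remove⁻ : ∀ {n} (S : EntrySet n) (c d : Cell n) → d ∈E remove S c → d ∈E S × d ≢ c
∈-remove⁻ S c d d∈ with d ≟ᶜ c
... | yes refl with () ← trans (≡-sym (remove-self S c)) d∈
... | no d≢c  = trans (≡-sym (remove-other S c d d≢c)) d∈ , d≢c

size-bump : ∀ {n} (S T : EntrySet n) (c : Cell n) → S at c ≡ false → T at c ≡ true →
            (∀ d → d ≢ c → T at d ≡ S at d) → size T ≡ suc (size S)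
size-bump {n} S T (a , b) Sc Tc rest =
  sumAll-bump (count S) (count T) a
    (sumAll-bump (indicator ∘ S a) (indicator ∘ T a) b
       (trans (cong indicator Tc) (cong (suc ∘ indicator) (≡-sym Sc)))
       (λ j j≢b → cong indicator (rest (a , j) (j≢b ∘ cong proj₂))))
    (λ i i≢a → cong sum (map-cong (λ j → cong indicator (rest (i , j) (i≢a ∘ cong proj₁))) (allFin n)))
  where
  indicator : Bool → ℕ
  indicator x = if x then 1 else 0
  count : EntrySet n → Fin n → ℕ
  count U i = sum (map (λ j → indicator (U i j)) (allFin n))

size-add : ∀ {n} (S : EntrySet n) (c : Cell n) → ¬ c ∈E S → size (add S c) ≡ suc (size S)
size-add S c c∉S = size-bump S (add S c) c (¬-not c∉S) (add-self S c) (add-other S c)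

size-remove : ∀ {n} (S : EntrySet n) (c : Cell n) → c ∈E S → size S ≡ suc (size (remove S c))
size-remove S c c∈S =
  size-bump (remove S c) S c (remove-self S c) c∈S (λ d d≢c → ≡-sym (remove-other S c d d≢c))

data Kind : Set where
  Row Col Sym : Kind

next : Kind → Kind
next Row = Col
next Col = Sym
next Sym = Row

next≢ : ∀ k → next k ≢ k
next≢ Row ()
next≢ Col ()
next≢ Sym ()

next²≢ : ∀ k → next (next k) ≢ k
next²≢ Row ()
next²≢ Col ()
next²≢ Sym ()

other-kinds : ∀ k a → a ≢ k → a ≡ next k ⊎ a ≡ next (next k)
other-kinds Row Row a≢k = ⊥-elim (a≢k refl)
other-kinds Row Col _   = inj₁ refl
other-kinds Row Sym _   = inj₂ refl
other-kinds Col Row _   = inj₂ refl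
other-kinds Col Col a≢k = ⊥-elim (a≢k refl)
other-kinds Col Sym _   = inj₁ refl
other-kinds Sym Row _   = inj₁ refl
other-kinds Sym Col _   = inj₂ refl
other-kinds Sym Sym a≢k = ⊥-elim (a≢k refl)

module Growth {n : ℕ} (L : LatinSquare n) where

  coord : Kind → Cell n → Fin n
  coord Row (i , j) = i
  coord Col (i , j) = j
  coord Sym (i , j) = cell L i j

  line : Kind → Fin n → Line n
  line Row x = row x
  line Col x = col x
  line Sym x = sym x

  On : Cell n → Line n → Set
  On (i , j) ℓ = OnLine L i j ℓ

  on? : ∀ c ℓ → Dec (On c ℓ)
  on? (i , j) (row r) = i ≟ r
  on? (i , j) (col r) = j ≟ r
  on? (i , j) (sym r) = cell L i j ≟ r

  on⇒ : ∀ a c x → On c (line a x) → coord a c ≡ x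
  on⇒ Row c x c∈ = c∈
  on⇒ Col c x c∈ = c∈
  on⇒ Sym c x c∈ = c∈

  ⇒on : ∀ a c x → coord a c ≡ x → On c (line a x)
  ⇒on Row c x c∈ = c∈
  ⇒on Col c x c∈ = c∈
  ⇒on Sym c x c∈ = c∈

  line-view : (ℓ : Line n) → Σ Kind λ a → Σ (Fin n) λ x → ℓ ≡ line a x
  line-view (row x) = Row , x , refl
  line-view (col x) = Col , x , refl
  line-view (sym x) = Sym , x , refl

  agree : ∀ a b → a ≢ b → ∀ c d → coord a c ≡ coord a d → coord b c ≡ coord b d → c ≡ d
  agree Row Row a≢b _ _ _ _ = ⊥-elim (a≢b refl)
  agree Col Col a≢b _ _ _ _ = ⊥-elim (a≢b refl)
  agree Sym Sym a≢b _ _ _ _ = ⊥-elim (a≢b refl)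
  agree Row Col _ (i , j) (i' , j') p q = cong₂ _,_ p q
  agree Col Row _ (i , j) (i' , j') p q = cong₂ _,_ q p
  agree Row Sym _ (i , j) (.i , j') refl q = cong (i ,_) (row-inj L i j j' q)
  agree Sym Row _ (i , j) (.i , j') q refl = cong (i ,_) (row-inj L i j j' q)
  agree Col Sym _ (i , j) (i' , .j) refl q = cong (_, j) (col-inj L j i i' q)
  agree Sym Col _ (i , j) (i' , .j) q refl = cong (_, j) (col-inj L j i i' q)

  exist : ∀ a b → a ≢ b → ∀ x y → ∃ λ c → coord a c ≡ x × coord b c ≡ y
  exist Row Row a≢b x y = ⊥-elim (a≢b refl)
  exist Col Col a≢b x y = ⊥-elim (a≢b refl)
  exist Sym Sym a≢b x y = ⊥-elim (a≢b refl)
  exist Row Col _ x y = (x , y) , refl , refl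
  exist Col Row _ x y = (y , x) , refl , refl
  exist Row Sym _ x y = let (j , p) = row-surj L x y in (x , j) , refl , p
  exist Sym Row _ x y = let (j , p) = row-surj L y x in (y , j) , p , refl
  exist Col Sym _ x y = let (i , p) = col-surj L x y in (i , x) , refl , p
  exist Sym Col _ x y = let (i , p) = col-surj L y x in (i , y) , p , refl

  Rep : EntrySet n → Line n → Set
  Rep S ℓ = ∃ λ r → r ∈E S × On r ℓ

  Other : EntrySet n → Cell n → Line n → Set
  Other S p ℓ = ∃ λ r → r ∈E S × r ≢ p × On r ℓ

  Private : EntrySet n → Cell n → Line n → Set
  Private S p ℓ = On p ℓ × ¬ Other S p ℓ

  Irredundant : EntrySet n → Set
  Irredundant S = ∀ p → p ∈E S → ∃ (Private S p)

  Survives : EntrySet n → Cell n → Cell n → Set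
  Survives S e p = ∃ λ ℓ → Private S p ℓ × ¬ On e ℓ

  Dies : EntrySet n → Cell n → Cell n → Set
  Dies S e p = p ∈E S × ¬ Survives S e p

  ∃cell? : {Q : Cell n → Set} → (∀ c → Dec (Q c)) → Dec (∃ Q)
  ∃cell? Q? with any? (λ i → any? (λ j → Q? (i , j)))
  ... | yes (i , j , q) = yes ((i , j) , q)
  ... | no none         = no λ { ((i , j) , q) → none (i , j , q) }

  ∃line? : {Q : Line n → Set} → (∀ ℓ → Dec (Q ℓ)) → Dec (∃ Q)
  ∃line? Q? with any? (Q? ∘ row) | any? (Q? ∘ col) | any? (Q? ∘ sym)
  ... | yes (i , q) | _           | _           = yes (row i , q)
  ... | no _        | yes (i , q) | _           = yes (col i , q)
  ... | no _        | no _        | yes (i , q) = yes (sym i , q)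
  ... | no noR      | no noC      | no noS      =
    no λ { (row i , q) → noR (i , q) ; (col i , q) → noC (i , q) ; (sym i , q) → noS (i , q) }

  ∈? : ∀ (S : EntrySet n) c → Dec (c ∈E S)
  ∈? S c = S at c Bool.≟ true

  Rep? : ∀ S ℓ → Dec (Rep S ℓ)
  Rep? S ℓ = ∃cell? (λ r → ∈? S r ×-dec on? r ℓ)

  Other? : ∀ S p ℓ → Dec (Other S p ℓ)
  Other? S p ℓ = ∃cell? (λ r → ∈? S r ×-dec (¬? (r ≟ᶜ p) ×-dec on? r ℓ))

  Private? : ∀ S p ℓ → Dec (Private S p ℓ)
  Private? S p ℓ = on? p ℓ ×-dec ¬? (Other? S p ℓ)

  Survives? : ∀ S e p → Dec (Survives S e p)
  Survives? S e p = ∃line? (λ ℓ → Private? S p ℓ ×-dec ¬? (on? e ℓ))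

  Dies? : ∀ S e p → Dec (Dies S e p)
  Dies? S e p = ∈? S p ×-dec ¬? (Survives? S e p)

  not-private⇒other : ∀ S p ℓ → On p ℓ → ¬ Private S p ℓ → Other S p ℓ
  not-private⇒other S p ℓ p∈ℓ notPrivate =
    decidable-stable (Other? S p ℓ) (λ noOther → notPrivate (p∈ℓ , noOther))

  private-unique : ∀ S p q ℓ → Private S p ℓ → q ∈E S → On q ℓ → q ≡ p
  private-unique S p q ℓ (_ , noOther) q∈S q∈ℓ =
    decidable-stable (q ≟ᶜ p) (λ q≢p → noOther (q , q∈S , q≢p , q∈ℓ))

  dies⇒on : ∀ S e p ℓ → Dies S e p → Private S p ℓ → On e ℓ
  dies⇒on S e p ℓ (_ , dead) priv = decidable-stable (on? e ℓ) (λ e∉ℓ → dead (ℓ , priv , e∉ℓ))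

  rep⇒represents : ∀ S ℓ → Rep S ℓ → Represents L S ℓ
  rep⇒represents S ℓ (r , r∈S , r∈ℓ) = proj₁ r , proj₂ r , r∈S , r∈ℓ

  -- An entry of P without a private line is redundant: every line through it
  -- is met by another entry of P.
  pmc⇒irredundant : ∀ P → PartialMinimalCover L P → Irredundant P
  pmc⇒irredundant P pmc p p∈P with ∃line? (Private? P p)
  ... | yes priv     = priv
  ... | no noPrivate = ⊥-elim (pmc p (p∈P , λ ℓ → mk⇔ (keep ℓ) (back ℓ)))
    where
    keep : ∀ ℓ → Represents L P ℓ → Represents L (remove P p) ℓ
    keep ℓ (i , j , x , o) with (i , j) ≟ᶜ p
    ... | no ne = i , j , ∈-remove P p (i , j) x ne , o
    ... | yes refl with not-private⇒other P p ℓ o (λ priv → noPrivate (ℓ , priv))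
    ... | r , r∈P , r≢p , r∈ℓ = rep⇒represents (remove P p) ℓ (r , ∈-remove P p r r∈P r≢p , r∈ℓ)
    back : ∀ ℓ → Represents L (remove P p) ℓ → Represents L P ℓ
    back ℓ (i , j , x , o) = i , j , proj₁ (∈-remove⁻ P p (i , j) x) , o

  allLines : List (Line n)
  allLines = tabulate row ++ tabulate col ++ tabulate sym

  meets-all⇒cover : ∀ C → All (Rep C) allLines → Cover L C
  meets-all⇒cover C meets ℓ = rep⇒represents C ℓ (rep ℓ)
    where
    others = ++⁻ʳ (tabulate row) meets
    rep : ∀ ℓ → Rep C ℓ
    rep (row i) = tabulate⁻ (++⁻ˡ (tabulate row) meets) i
    rep (col i) = tabulate⁻ (++⁻ˡ (tabulate col) others) i
    rep (sym i) = tabulate⁻ (++⁻ʳ (tabulate col) others) i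

  -- An irredundant cover is minimal: removing an entry uncovers its private line.
  irredundant-cover⇒minimal : ∀ C → Irredundant C → Cover L C → MinimalCover L C
  irredundant-cover⇒minimal C irr cover = cover , minimal
    where
    minimal : ∀ e → e ∈E C → ¬ Cover L (remove C e)
    minimal e e∈C cover' with irr e e∈C
    ... | ℓ , _ , noOther with cover' ℓ
    ... | i , j , x , o = noOther ((i , j) , proj₁ (∈-remove⁻ C e (i , j) x)
                                           , proj₂ (∈-remove⁻ C e (i , j) x) , o)

  record _⊑_ (S S' : EntrySet n) : Set where
    constructor improves
    field
      irredundant : Irredundant S'
      no-smaller  : size S ≤ size S'
      meets-more  : ∀ ℓ → Rep S ℓ → Rep S' ℓ
  open _⊑_ public

  ⊑-refl : ∀ {S} → Irredundant S → S ⊑ S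
  ⊑-refl irr = improves irr ≤-refl (λ _ rep → rep)

  ⊑-trans : ∀ {S T U} → S ⊑ T → T ⊑ U → S ⊑ U
  ⊑-trans S⊑T T⊑U = improves (irredundant T⊑U) (≤-trans (no-smaller S⊑T) (no-smaller T⊑U))
                             (λ ℓ → meets-more T⊑U ℓ ∘ meets-more S⊑T ℓ)

  -- A set T consisting of e, which lies on a line u missed by S, and of
  -- entries of S surviving the addition of e, is irredundant: u is private
  -- to e, and each survivor keeps a private line avoiding e.
  irredundant-with : ∀ S T e u → ¬ Rep S u → On e u →
                     (∀ r → r ∈E T → r ∈E S ⊎ r ≡ e) →
                     (∀ p → p ∈E T → p ∈E S → Survives S e p) → Irredundant T
  irredundant-with S T e u missed e∈u fromS survive p p∈T with fromS p p∈T
  ... | inj₂ refl = u , e∈u , noRival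
    where
    noRival : ¬ Other T p u
    noRival (r , r∈T , r≢e , r∈u) with fromS r r∈T
    ... | inj₁ r∈S = missed (r , r∈S , r∈u)
    ... | inj₂ r≡e = r≢e r≡e
  ... | inj₁ p∈S with survive p p∈T p∈S
  ... | ℓ , (p∈ℓ , noOther) , e∉ℓ = ℓ , p∈ℓ , noRival
    where
    noRival : ¬ Other T p ℓ
    noRival (r , r∈T , r≢p , r∈ℓ) with fromS r r∈T
    ... | inj₁ r∈S  = noOther (r , r∈S , r≢p , r∈ℓ)
    ... | inj₂ refl = e∉ℓ r∈ℓ

  grow-by-adding : ∀ S u e → ¬ Rep S u → On e u → (∀ p → ¬ Dies S e p) →
                   S ⊑ add S e × Rep (add S e) u
  grow-by-adding S u e missed e∈u noneDie =
    improves (irredundant-with S (add S e) e u missed e∈u (∈-add⁻ S e) survive)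
             (subst (size S ≤_) (≡-sym (size-add S e e∉S)) (n≤1+n (size S)))
             (λ { ℓ (r , r∈S , r∈ℓ) → r , ∈-add S e r r∈S , r∈ℓ })
    , (e , add-self S e , e∈u)
    where
    e∉S : ¬ e ∈E S
    e∉S e∈S = missed (e , e∈S , e∈u)
    survive : ∀ p → p ∈E add S e → p ∈E S → Survives S e p
    survive p _ p∈S = decidable-stable (Survives? S e p) (λ dead → noneDie p (p∈S , dead))

  -- Growth step when q is the only dying entry: replace q by e.  The size is
  -- unchanged, and a line that only q met was private to q, so e lies on it.
  grow-by-swapping : ∀ S u e q → ¬ Rep S u → On e u → Dies S e q →
                     (∀ p → Dies S e p → p ≡ q) →
                     S ⊑ remove (add S e) q × Rep (remove (add S e) q) u
  grow-by-swapping S u e q missed e∈u qDies onlyQ =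
    improves (irredundant-with S S' e u missed e∈u fromS survive) (≤-reflexive sameSize) keep
    , (e , e∈S' , e∈u)
    where
    S' = remove (add S e) q
    e∉S : ¬ e ∈E S
    e∉S e∈S = missed (e , e∈S , e∈u)
    q∈S : q ∈E S
    q∈S = proj₁ qDies
    e∈S' : e ∈E S'
    e∈S' = ∈-remove (add S e) q e (add-self S e) (λ { refl → e∉S q∈S })
    old∈S' : ∀ r → r ∈E S → r ≢ q → r ∈E S'
    old∈S' r r∈S r≢q = ∈-remove (add S e) q r (∈-add S e r r∈S) r≢q
    fromS : ∀ r → r ∈E S' → r ∈E S ⊎ r ≡ e
    fromS r r∈S' = ∈-add⁻ S e r (proj₁ (∈-remove⁻ (add S e) q r r∈S'))
    survive : ∀ p → p ∈E S' → p ∈E S → Survives S e p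
    survive p p∈S' p∈S = decidable-stable (Survives? S e p)
      (λ dead → proj₂ (∈-remove⁻ (add S e) q p p∈S') (onlyQ p (p∈S , dead)))
    sameSize : size S ≡ size S'
    sameSize = suc-injective (trans (≡-sym (size-add S e e∉S))
                                    (size-remove (add S e) q (∈-add S e q q∈S)))
    keep : ∀ ℓ → Rep S ℓ → Rep S' ℓ
    keep ℓ (r , r∈S , r∈ℓ) with r ≟ᶜ q
    ... | no r≢q = r , old∈S' r r∈S r≢q , r∈ℓ
    ... | yes refl with Private? S r ℓ
    ... | yes priv   = e , e∈S' , dies⇒on S e r ℓ qDies priv
    ... | no notPriv with not-private⇒other S r ℓ r∈ℓ notPriv
    ... | r' , r'∈S , r'≢q , r'∈ℓ = r' , old∈S' r' r'∈S r'≢q , r'∈ℓ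

  grow-at : ∀ S u e → ¬ Rep S u → On e u → (∀ p q → Dies S e p → Dies S e q → p ≡ q) →
            ∃ λ S' → S ⊑ S' × Rep S' u
  grow-at S u e missed e∈u atMostOne with ∃cell? (Dies? S e)
  ... | no noneDie = add S e , grow-by-adding S u e missed e∈u (λ p pDies → noneDie (p , pDies))
  ... | yes (q , qDies) = remove (add S e) q
    , grow-by-swapping S u e q missed e∈u qDies (λ p pDies → atMostOne p q pDies qDies)

  dying-line : ∀ S k v e → Irredundant S → ¬ Rep S (line k v) → coord k e ≡ v →
               ∀ p → Dies S e p → Σ Kind λ a → a ≢ k × Private S p (line a (coord a e))
  dying-line S k v e irr missed e∈u p pDies with irr p (proj₁ pDies)
  ... | ℓ , priv with line-view ℓ
  ... | a , x , refl with on⇒ a e x (dies⇒on S e p (line a x) pDies priv)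
  ... | refl = a , a≢k , priv
    where
    a≢k : a ≢ k
    a≢k refl = missed (p , proj₁ pDies , ⇒on k p v (trans (on⇒ k p (coord k e) (proj₁ priv)) e∈u))

  -- A dying entry private on a line of kind a, sharing with e its coordinate
  -- of another kind b, is e itself (it also shares e's coordinate of kind a).
  dies-on-two-lines : ∀ S e p a b x → a ≢ b → Dies S e p → Private S p (line a x) →
                      coord b p ≡ coord b e → p ≡ e
  dies-on-two-lines S e p a b x a≢b pDies priv same-b =
    agree a b a≢b p e (trans (on⇒ a p x (proj₁ priv)) (≡-sym (on⇒ a e x e∈ℓ))) same-b
    where
    e∈ℓ : On e (line a x)
    e∈ℓ = dies⇒on S e p (line a x) pDies priv

  -- On a line of kind k missed by S there is an entry e all of whose dying
  -- entries are private on one common line.  Take any e₀ on it.  If no dying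
  -- entry lies on e₀'s line of kind next k, all use kind next (next k).
  -- Otherwise take such a dying p₀ and the entry e sharing p₀'s line of kind
  -- next (next k): then all dying entries for e use kind next k.
  good-entry : ∀ S k v → Irredundant S → ¬ Rep S (line k v) →
               ∃ λ e → coord k e ≡ v × ∃ λ m → ∀ p → Dies S e p → Private S p m
  good-entry S k v irr missed with exist k (next k) (next≢ k ∘ ≡-sym) v v
  ... | e₀ , e₀∈u , _ with ∃cell? (λ p → Dies? S e₀ p ×-dec on? p (line (next k) (coord (next k) e₀)))
  ... | no none = e₀ , e₀∈u , line (next (next k)) (coord (next (next k)) e₀) , common
    where
    common : ∀ p → Dies S e₀ p → Private S p (line (next (next k)) (coord (next (next k)) e₀))
    common p pDies with dying-line S k v e₀ irr missed e₀∈u p pDies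
    ... | a , a≢k , priv with other-kinds k a a≢k
    ... | inj₁ refl = ⊥-elim (none (p , pDies , proj₁ priv))
    ... | inj₂ refl = priv
  ... | yes (p₀ , p₀Dies , p₀∈ℓ₁) with exist k (next (next k)) (next²≢ k ∘ ≡-sym) v (coord (next (next k)) p₀)
  ... | e , e∈u , e~p₀ = e , e∈u , line (next k) (coord (next k) e) , common
    where
    common : ∀ q → Dies S e q → Private S q (line (next k) (coord (next k) e))
    common q qDies with dying-line S k v e irr missed e∈u q qDies
    ... | a , a≢k , priv with other-kinds k a a≢k
    ... | inj₁ refl = priv
    ... | inj₂ refl = ⊥-elim (missed (e₀ , subst (_∈E S) p₀≡e₀ (proj₁ p₀Dies) , ⇒on k e₀ v e₀∈u))
      where
      p₀≡q : p₀ ≡ q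
      p₀≡q = private-unique S q p₀ _ priv (proj₁ p₀Dies) (⇒on (next (next k)) p₀ _ (≡-sym e~p₀))
      p₀≡e₀ : p₀ ≡ e₀
      p₀≡e₀ = dies-on-two-lines S e₀ p₀ (next (next k)) (next k) _ (next≢ (next k)) p₀Dies
                (subst (λ r → Private S r _) (≡-sym p₀≡q) priv) (on⇒ (next k) p₀ _ p₀∈ℓ₁)

  grow-to-meet : ∀ S ℓ → Irredundant S → ∃ λ S' → S ⊑ S' × Rep S' ℓ
  grow-to-meet S ℓ irr with Rep? S ℓ | line-view ℓ
  ... | yes met    | _            = S , ⊑-refl irr , met
  ... | no missed  | k , v , refl with good-entry S k v irr missed
  ... | e , e∈u , m , common = grow-at S (line k v) e missed (⇒on k e v e∈u) atMostOne
    where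
    atMostOne : ∀ p q → Dies S e p → Dies S e q → p ≡ q
    atMostOne p q pDies qDies =
      ≡-sym (private-unique S p q m (common p pDies) (proj₁ qDies) (proj₁ (common q qDies)))

  grow-to-meet-all : ∀ (ls : List (Line n)) S → Irredundant S → ∃ λ S' → S ⊑ S' × All (Rep S') ls
  grow-to-meet-all [] S irr = S , ⊑-refl irr , []
  grow-to-meet-all (ℓ ∷ ls) S irr with grow-to-meet S ℓ irr
  ... | S₁ , S⊑S₁ , meetsℓ with grow-to-meet-all ls S₁ (irredundant S⊑S₁)
  ... | S₂ , S₁⊑S₂ , meetsls = S₂ , ⊑-trans S⊑S₁ S₁⊑S₂ , meets-more S₁⊑S₂ ℓ meetsℓ ∷ meetsls

open Growth using (irredundant; no-smaller; allLines; grow-to-meet-all;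
                   pmc⇒irredundant; meets-all⇒cover; irredundant-cover⇒minimal)

lemma3p6 : ∀ {n} (L : LatinSquare n) (P : EntrySet n) →
    PartialMinimalCover L P →
    ∃ λ C → MinimalCover L C × size P ≤ size C
lemma3p6 L P pmc with grow-to-meet-all L (allLines L) P (pmc⇒irredundant L P pmc)
... | C , P⊑C , meetsAll =
  C , irredundant-cover⇒minimal L C (irredundant P⊑C) (meets-all⇒cover L C meetsAll) , no-smaller P⊑C
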